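{- Let $f$ be a weakly $\epsilon$-modular set function over $U=[n]$ ($n\ge2$) whose closest linear set function is the zero function, and let $M=\max_S|f(S)|$. Then there exists $k'\in\mathbb{N}$ such that for every positive integer multiple $k$ of $k'$, there is a collection (multiset) $\mathrm{PS}^*$ of $2k$ subsets of $U$ such that every item of $U$ lies in exactly $k$ of the sets of $\mathrm{PS}^*$ (counted with multiplicity), and, letting $\mathrm{NS}^*$ be the collection of complements $\{U\setminus P: P\in\mathrm{PS}^*\}$ (which then also has every item in exactly $k$ of its $2k$ sets), the average deficit $d$ of $\mathrm{PS}^*$ and the average surplus $s$ of $\mathrm{NS}^*$ satisfy $d+s\le\epsilon$.
   Context: A set function over $U$ is $f:2^U\to\mathbb{R}$; weakly $\epsilon$-modular means $|f(S)+f(T)-f(S\cup T)-f(S\cap T)|\le\epsilon$ for all disjoint $S,T$. A linear set function is $\ell(S)=c_0+\sum_{i\in S}c_i$. "The closest linear set function to $f$ is the zero function" means that the zero function minimizes $\max_S|f(S)-\ell(S)|$ over all linear $\ell$ (i.e. $f$ is $\Delta$-linear for no $\Delta<M$). A set $S$ has deficit $M-f(S)$ and surplus $f(S)+M$; the average deficit (surplus) of a collection is the average of the deficits (surpluses) of its sets, counted with multiplicity. -}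

module Defs where

open import Level using (0ℓ)
open import Data.Nat as ℕ using (ℕ; zero; suc)
open import Data.Bool using (Bool; true; false; if_then_else_)
open import Data.Fin as Fin using (Fin)
open import Data.Fin.Subset using (Subset; _∈_; _∉_; _∪_; _∩_; ∁)
open import Data.Vec using (Vec; []; _∷_; lookup; map)
open import Data.Product using (Σ; ∃; _×_; _,_)
open import Data.Sum using (_⊎_)
open import Relation.Nullary using (¬_)
open import Relation.Binary.PropositionalEquality using (_≡_)
open import Algebra.Structures using (IsCommutativeRing)

-- The real numbers, given axiomatically: a complete ordered field
-- (the axioms are categorical, so any model is ℝ).
record RealField : Set₁ where
  infixl 6 _+_ _-_
  infixl 7 _*_
  infix 4 _≤_
  field
    R : Set
    0# 1# : R
    _+_ _*_ : R → R → R
    -_ : R → R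
    _⁻¹ : R → R
    _≤_ : R → R → Set
    isCommutativeRing : IsCommutativeRing _≡_ _+_ _*_ -_ 0# 1#
    0≢1 : ¬ (0# ≡ 1#)
    ⁻¹-inverse : ∀ x → ¬ (x ≡ 0#) → x * (x ⁻¹) ≡ 1#
    ≤-refl : ∀ x → x ≤ x
    ≤-trans : ∀ {x y z} → x ≤ y → y ≤ z → x ≤ z
    ≤-antisym : ∀ {x y} → x ≤ y → y ≤ x → x ≡ y
    ≤-total : ∀ x y → x ≤ y ⊎ y ≤ x
    +-mono-≤ : ∀ {x y} z → x ≤ y → x + z ≤ y + z
    *-nonneg : ∀ {x y} → 0# ≤ x → 0# ≤ y → 0# ≤ x * y
    sup : (P : R → Set) → (∃ P) → (∃ λ b → ∀ x → P x → x ≤ b) →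
          ∃ λ s → (∀ x → P x → x ≤ s) × (∀ b → (∀ x → P x → x ≤ b) → s ≤ b)

  _-_ : R → R → R
  x - y = x + (- y)

  abs≤ : R → R → Set
  abs≤ x e = (x ≤ e) × (- x ≤ e)

  abs≡ : R → R → Set
  abs≡ x e = (x ≡ e) ⊎ (- x ≡ e)

  fromℕ : ℕ → R
  fromℕ zero = 0#
  fromℕ (suc m) = 1# + fromℕ m

module SetFunctions (ℝ : RealField) where
  open RealField ℝ public

  SetFun : ℕ → Set
  SetFun n = Subset n → R

  Disjoint : ∀ {n} → Subset n → Subset n → Set
  Disjoint S T = ∀ i → i ∈ S → i ∉ T

  WeaklyModular : ∀ {n} → R → SetFun n → Set
  WeaklyModular {n} ε f = ∀ (S T : Subset n) → Disjoint S T →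
    abs≤ (f S + f T - f (S ∪ T) - f (S ∩ T)) ε

  sumIn : ∀ {n} → (Fin n → R) → Subset n → R
  sumIn {zero} c [] = 0#
  sumIn {suc n} c (b ∷ S) = (if b then c Fin.zero else 0#) + sumIn (λ i → c (Fin.suc i)) S

  linear : ∀ {n} → R → (Fin n → R) → SetFun n
  linear c0 c S = c0 + sumIn c S

  -- "the closest linear set function to f is the zero function":
  -- whenever some linear ℓ satisfies |f(S) − ℓ(S)| ≤ Δ for all S,
  -- the zero function satisfies |f(S) − 0| ≤ Δ for all S.
  ClosestLinearIsZero : ∀ {n} → SetFun n → Set
  ClosestLinearIsZero {n} f = ∀ (c0 : R) (c : Fin n → R) (Δ : R) →
    (∀ S → abs≤ (f S - linear c0 c S) Δ) → (∀ S → abs≤ (f S) Δ)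

  IsMaxAbs : ∀ {n} → SetFun n → R → Set
  IsMaxAbs f M = (∀ S → abs≤ (f S) M) × (∃ λ S → abs≡ (f S) M)

  count : ∀ {n m} → Fin n → Vec (Subset n) m → ℕ
  count i [] = 0
  count i (P ∷ Ps) = (if lookup P i then 1 else 0) ℕ.+ count i Ps

  sumR : ∀ {m} → Vec R m → R
  sumR [] = 0#
  sumR (x ∷ xs) = x + sumR xs

  average : ∀ {m} → Vec R m → R
  average {m} xs = sumR xs * (fromℕ m ⁻¹)

  deficit : ∀ {n} → SetFun n → R → Subset n → R
  deficit f M S = M - f S

  surplus : ∀ {n} → SetFun n → R → Subset n → R
  surplus f M S = f S + M

  complements : ∀ {n m} → Vec (Subset n) m → Vec (Subset n) m
  complements = map ∁

  averageDeficit : ∀ {n m} → SetFun n → R → Vec (Subset n) m → R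
  averageDeficit f M Ps = average (map (deficit f M) Ps)

  averageSurplus : ∀ {n m} → SetFun n → R → Vec (Subset n) m → R
  averageSurplus f M Ns = average (map (surplus f M) Ns)

module Submission where

-- The system |f(S) − ℓ(S)| ≤ Δ (S ⊆ U) is linear in the coefficients of ℓ, and
-- Fourier–Motzkin elimination reduces its solvability to finitely many conditions
-- Δ ≥ (Σ_{P ∈ Ps} f(P) − Σ_{N ∈ Ns} f(N)) / 2m, one for each pair of m-element families
-- Ps, Ns covering every item equally often. As the zero function is closest, M is at
-- most the largest of these bounds, so some pair has 2m·M ≤ Σ f(Ps) − Σ f(Ns).
-- Then q copies of Ps together with the complements of q copies of Ns are 2k sets,
-- k = qm, covering every item exactly k times. Weak modularity on X, U ∖ X bounds the
-- deficit of X plus the surplus of U ∖ X by 2M + ε + f(U) + f(∅) − 2f(X), and by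
-- 2M + ε − f(U) − f(∅) + 2f(N) when X = U ∖ N; summing, the pair inequality leaves
-- an average of at most ε.

open import Defs
open import Level using (0ℓ)
open import Function using (_∘_)
open import Data.Nat using (ℕ; zero; suc; _<_; s≤s; z≤n) renaming (_≤_ to _≤ℕ_; _+_ to _+ℕ_)
import Data.Nat as ℕ
import Data.Nat.Properties as ℕ
open import Data.Nat.Divisibility using (_∣_; divides)
open import Data.Integer as ℤ using (ℤ; -[1+_]; _⊖_)
import Data.Integer.Properties as ℤ
open import Data.Sign as Sign using (Sign)
open import Data.Bool using (true; false; if_then_else_; not)
open import Data.Product using (Σ; ∃; _×_; _,_; proj₁; proj₂)
open import Data.Sum using (inj₁; inj₂)
import Data.Maybe as Maybe
open import Data.Fin using (Fin; zero; suc)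
open import Data.Fin.Subset using (Subset; ∁; ⊤; ⊥; _∩_)
open import Data.Fin.Subset.Properties using (p∪∁p≡⊤; x∈p⇒x∉∁p)
open import Data.Vec as Vec using (Vec; []; _∷_; lookup)
import Data.Vec.Properties as Vec
import Data.Vec.Functional as Vector
open import Data.List as List using (List; []; _∷_; _++_; concatMap)
import Data.List.Extrema
open import Data.List.Relation.Unary.All as All using (All; []; _∷_)
import Data.List.Relation.Unary.All.Properties as All
open import Data.List.Relation.Unary.Any using (here)
open import Data.List.Membership.Propositional using (_∈_)
import Data.List.Membership.Propositional.Properties as ∈
open import Algebra.Bundles using (CommutativeRing)
open import Relation.Binary.Bundles using (TotalOrder)
import Relation.Binary.Reasoning.PartialOrder
open import Relation.Binary.PropositionalEquality
open import Relation.Nullary using (¬_; contradiction)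
open import Relation.Nullary.Decidable using (dec⇒maybe)

module RealFieldProperties (ℝ : RealField) where
  open RealField ℝ public renaming (+-mono-≤ to +-monoˡ-≤)

  commutativeRing : CommutativeRing 0ℓ 0ℓ
  commutativeRing = record { isCommutativeRing = isCommutativeRing }

  open CommutativeRing commutativeRing public
    using (+-assoc; +-comm; *-comm; *-assoc; +-identityˡ; +-identityʳ; *-identityˡ; *-identityʳ;
           distribʳ; -‿inverseʳ; zeroˡ; zeroʳ)
  open import Algebra.Properties.Ring (CommutativeRing.ring commutativeRing)
    public using (-‿involutive; -0#≈0#; -‿distribˡ-*; -‿+-comm)

  fromℕ-+ : ∀ m n → fromℕ (m ℕ.+ n) ≡ fromℕ m + fromℕ n
  fromℕ-+ zero    n = sym (+-identityˡ _)
  fromℕ-+ (suc m) n = trans (cong (1# +_) (fromℕ-+ m n)) (sym (+-assoc _ _ _))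

  fromℕ-* : ∀ m n → fromℕ (m ℕ.* n) ≡ fromℕ m * fromℕ n
  fromℕ-* zero    n = sym (zeroˡ _)
  fromℕ-* (suc m) n = begin
    fromℕ (n ℕ.+ m ℕ.* n)      ≡⟨ fromℕ-+ n (m ℕ.* n) ⟩
    fromℕ n + fromℕ (m ℕ.* n)  ≡⟨ cong₂ _+_ (sym (*-identityˡ _)) (fromℕ-* m n) ⟩
    1# * fromℕ n + fromℕ m * fromℕ n ≡⟨ sym (distribʳ _ _ _) ⟩
    fromℕ (suc m) * fromℕ n    ∎
    where open ≡-Reasoning

  fromSign : Sign → R
  fromSign Sign.+ = 1#
  fromSign Sign.- = - 1#

  fromℤ : ℤ → R
  fromℤ (ℤ.+ n)  = fromℕ n
  fromℤ -[1+ n ] = - fromℕ (suc n)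

  fromSign-* : ∀ s t → fromSign (s Sign.* t) ≡ fromSign s * fromSign t
  fromSign-* Sign.+ t      = sym (*-identityˡ _)
  fromSign-* Sign.- Sign.+ = sym (*-identityʳ _)
  fromSign-* Sign.- Sign.- = sym (begin
    - 1# * - 1#    ≡⟨ sym (-‿distribˡ-* 1# (- 1#)) ⟩
    - (1# * - 1#)  ≡⟨ cong -_ (*-identityˡ _) ⟩
    - - 1#         ≡⟨ -‿involutive 1# ⟩
    1#             ∎)
    where open ≡-Reasoning

  fromℤ-◃ : ∀ s n → fromℤ (s ℤ.◃ n) ≡ fromSign s * fromℕ n
  fromℤ-◃ s      zero    = sym (zeroʳ _)
  fromℤ-◃ Sign.+ (suc n) = sym (*-identityˡ _)
  fromℤ-◃ Sign.- (suc n) = trans (cong -_ (sym (*-identityˡ _))) (-‿distribˡ-* 1# _)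

  fromℤ-⊖ : ∀ m n → fromℤ (m ⊖ n) ≡ fromℕ m - fromℕ n
  fromℤ-⊖ zero    zero    = sym (trans (+-identityˡ _) -0#≈0#)
  fromℤ-⊖ zero    (suc n) = sym (+-identityˡ _)
  fromℤ-⊖ (suc m) zero    = sym (trans (cong (fromℕ (suc m) +_) -0#≈0#) (+-identityʳ _))
  fromℤ-⊖ (suc m) (suc n) = begin
    fromℤ (suc m ⊖ suc n)       ≡⟨ cong fromℤ (ℤ.[1+m]⊖[1+n]≡m⊖n m n) ⟩
    fromℤ (m ⊖ n)               ≡⟨ fromℤ-⊖ m n ⟩
    fromℕ m - fromℕ n           ≡⟨ sym (cancel 1# (fromℕ m) (fromℕ n)) ⟩
    (1# + fromℕ m) - (1# + fromℕ n) ∎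
    where
    open ≡-Reasoning
    cancel : ∀ a x y → (a + x) - (a + y) ≡ x - y
    cancel a x y = begin
      (a + x) + - (a + y)        ≡⟨ cong ((a + x) +_) (sym (-‿+-comm a y)) ⟩
      (a + x) + (- a + - y)      ≡⟨ cong (_+ (- a + - y)) (+-comm a x) ⟩
      (x + a) + (- a + - y)      ≡⟨ +-assoc x a _ ⟩
      x + (a + (- a + - y))      ≡⟨ cong (x +_) (sym (+-assoc a (- a) (- y))) ⟩
      x + ((a + - a) + - y)      ≡⟨ cong (λ z → x + (z + - y)) (-‿inverseʳ a) ⟩
      x + (0# + - y)             ≡⟨ cong (x +_) (+-identityˡ (- y)) ⟩
      x + - y                    ∎

  fromℤ-neg : ∀ i → fromℤ (ℤ.- i) ≡ - fromℤ i
  fromℤ-neg (ℤ.+ zero)  = sym -0#≈0#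
  fromℤ-neg (ℤ.+ suc n) = refl
  fromℤ-neg -[1+ n ]    = sym (-‿involutive _)

  fromℤ-+ : ∀ i j → fromℤ (i ℤ.+ j) ≡ fromℤ i + fromℤ j
  fromℤ-+ (ℤ.+ m)  (ℤ.+ n)  = fromℕ-+ m n
  fromℤ-+ (ℤ.+ m)  -[1+ n ] = fromℤ-⊖ m (suc n)
  fromℤ-+ -[1+ m ] (ℤ.+ n)  = trans (fromℤ-⊖ n (suc m)) (+-comm _ _)
  fromℤ-+ -[1+ m ] -[1+ n ] = begin
    - fromℕ (suc (suc (m ℕ.+ n)))          ≡⟨ cong (λ k → - fromℕ (suc k)) (sym (ℕ.+-suc m n)) ⟩
    - fromℕ (suc m ℕ.+ suc n)              ≡⟨ cong -_ (fromℕ-+ (suc m) (suc n)) ⟩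
    - (fromℕ (suc m) + fromℕ (suc n))      ≡⟨ sym (-‿+-comm _ _) ⟩
    - fromℕ (suc m) + - fromℕ (suc n)      ∎
    where open ≡-Reasoning

  fromℤ-* : ∀ i j → fromℤ (i ℤ.* j) ≡ fromℤ i * fromℤ j
  fromℤ-* i j = begin
    fromℤ (i ℤ.* j)                                 ≡⟨ fromℤ-◃ (s Sign.* t) (a ℕ.* b) ⟩
    fromSign (s Sign.* t) * fromℕ (a ℕ.* b)         ≡⟨ cong₂ _*_ (fromSign-* s t) (fromℕ-* a b) ⟩
    (fromSign s * fromSign t) * (fromℕ a * fromℕ b) ≡⟨ interchange (fromSign s) (fromSign t) (fromℕ a) (fromℕ b) ⟩
    (fromSign s * fromℕ a) * (fromSign t * fromℕ b) ≡⟨ sym (cong₂ _*_ (signAbs i) (signAbs j)) ⟩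
    fromℤ i * fromℤ j                               ∎
    where
    open ≡-Reasoning
    s = ℤ.sign i
    t = ℤ.sign j
    a = ℤ.∣ i ∣
    b = ℤ.∣ j ∣
    signAbs : ∀ k → fromℤ k ≡ fromSign (ℤ.sign k) * fromℕ ℤ.∣ k ∣
    signAbs k = trans (cong fromℤ (sym (ℤ.◃-inverse k))) (fromℤ-◃ (ℤ.sign k) ℤ.∣ k ∣)
    interchange : ∀ w x y z → (w * x) * (y * z) ≡ (w * y) * (x * z)
    interchange w x y z = begin
      (w * x) * (y * z)  ≡⟨ *-assoc w x _ ⟩
      w * (x * (y * z))  ≡⟨ cong (w *_) (sym (*-assoc x y z)) ⟩
      w * ((x * y) * z)  ≡⟨ cong (λ u → w * (u * z)) (*-comm x y) ⟩
      w * ((y * x) * z)  ≡⟨ cong (w *_) (*-assoc y x z) ⟩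
      w * (y * (x * z))  ≡⟨ sym (*-assoc w y _) ⟩
      (w * y) * (x * z)  ∎

  open import Algebra.Solver.Ring.AlmostCommutativeRing
    using (AlmostCommutativeRing; fromCommutativeRing; _-Raw-AlmostCommutative⟶_)

  -- With integer coefficients the ring solver can cancel constants such as 1 − 1.
  fromℤ-homomorphism : ℤ.+-*-rawRing -Raw-AlmostCommutative⟶ fromCommutativeRing commutativeRing
  fromℤ-homomorphism = record
    { ⟦_⟧ = fromℤ ; +-homo = fromℤ-+ ; *-homo = fromℤ-* ; -‿homo = fromℤ-neg
    ; 0-homo = refl ; 1-homo = +-identityʳ 1# }

  open import Algebra.Solver.Ring ℤ.+-*-rawRing (fromCommutativeRing commutativeRing) fromℤ-homomorphism
    (λ i j → Maybe.map (cong fromℤ) (dec⇒maybe (i ℤ.≟ j)))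
    public using (solve; _:=_; _:+_; _:*_; _:-_; :-_; con)

  ≤-totalOrder : TotalOrder 0ℓ 0ℓ 0ℓ
  ≤-totalOrder = record
    { _≤_ = _≤_
    ; isTotalOrder = record
      { isPartialOrder = record
        { isPreorder = record
          { isEquivalence = isEquivalence
          ; reflexive = λ { refl → ≤-refl _ }
          ; trans = ≤-trans }
        ; antisym = ≤-antisym }
      ; total = ≤-total } }

  module ≤-Reasoning = Relation.Binary.Reasoning.PartialOrder (TotalOrder.poset ≤-totalOrder)
  open ≤-Reasoning

  x≤y⇒0≤y-x : ∀ {x y} → x ≤ y → 0# ≤ y - x
  x≤y⇒0≤y-x {x} {y} x≤y = begin
    0#      ≡⟨ sym (-‿inverseʳ x) ⟩
    x - x   ≤⟨ +-monoˡ-≤ (- x) x≤y ⟩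
    y - x   ∎

  0≤y-x⇒x≤y : ∀ {x y} → 0# ≤ y - x → x ≤ y
  0≤y-x⇒x≤y {x} {y} 0≤y-x = begin
    x              ≡⟨ sym (+-identityˡ x) ⟩
    0# + x         ≤⟨ +-monoˡ-≤ x 0≤y-x ⟩
    (y - x) + x    ≡⟨ solve 2 (λ x y → (y :- x) :+ x := y) refl x y ⟩
    y              ∎

  ≤-by-difference : ∀ {a b c d} → a ≤ b → b - a ≡ d - c → c ≤ d
  ≤-by-difference a≤b eq = 0≤y-x⇒x≤y (subst (0# ≤_) eq (x≤y⇒0≤y-x a≤b))

  +-mono-≤ : ∀ {a b c d} → a ≤ b → c ≤ d → a + c ≤ b + d
  +-mono-≤ {a} {b} {c} {d} a≤b c≤d = begin
    a + c   ≤⟨ +-monoˡ-≤ c a≤b ⟩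
    b + c   ≡⟨ +-comm b c ⟩
    c + b   ≤⟨ +-monoˡ-≤ b c≤d ⟩
    d + b   ≡⟨ +-comm d b ⟩
    b + d   ∎

  *-monoˡ-≤-nonneg : ∀ {c a b} → 0# ≤ c → a ≤ b → c * a ≤ c * b
  *-monoˡ-≤-nonneg {c} {a} {b} 0≤c a≤b = 0≤y-x⇒x≤y (begin
    0#               ≤⟨ *-nonneg 0≤c (x≤y⇒0≤y-x a≤b) ⟩
    c * (b - a)      ≡⟨ solve 3 (λ c a b → c :* (b :- a) := c :* b :- c :* a) refl c a b ⟩
    c * b - c * a    ∎)

  0≤1 : 0# ≤ 1#
  0≤1 with ≤-total 0# 1#
  ... | inj₁ 0≤1 = 0≤1
  ... | inj₂ 1≤0 = begin
    0#            ≤⟨ *-nonneg 0≤-1 0≤-1 ⟩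
    - 1# * - 1#   ≡⟨ solve 1 (λ o → :- o :* :- o := o :* o) refl 1# ⟩
    1# * 1#       ≡⟨ *-identityˡ 1# ⟩
    1#            ∎
    where
    0≤-1 : 0# ≤ - 1#
    0≤-1 = begin
      0#          ≡⟨ sym (-‿inverseʳ 1#) ⟩
      1# - 1#     ≤⟨ +-monoˡ-≤ (- 1#) 1≤0 ⟩
      0# - 1#     ≡⟨ +-identityˡ (- 1#) ⟩
      - 1#        ∎

  0≤fromℕ : ∀ n → 0# ≤ fromℕ n
  0≤fromℕ zero    = ≤-refl 0#
  0≤fromℕ (suc n) = begin
    0#                 ≡⟨ sym (+-identityˡ 0#) ⟩
    0# + 0#            ≤⟨ +-mono-≤ 0≤1 (0≤fromℕ n) ⟩
    1# + fromℕ n       ∎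

  1≰0 : ¬ (1# ≤ 0#)
  1≰0 1≤0 = 0≢1 (≤-antisym 0≤1 1≤0)

  1/suc : ℕ → R
  1/suc k = fromℕ (suc k) ⁻¹

  fromℕ-suc*1/suc : ∀ k → fromℕ (suc k) * 1/suc k ≡ 1#
  fromℕ-suc*1/suc k = ⁻¹-inverse _ λ 1+k≡0 → 1≰0 (begin
    1#                 ≡⟨ sym (+-identityʳ 1#) ⟩
    1# + 0#            ≤⟨ +-mono-≤ (≤-refl 1#) (0≤fromℕ k) ⟩
    fromℕ (suc k)      ≡⟨ 1+k≡0 ⟩
    0#                 ∎)

  0≤1/suc : ∀ k → 0# ≤ 1/suc k
  0≤1/suc k with ≤-total 0# (1/suc k)
  ... | inj₁ 0≤1/suc = 0≤1/suc
  ... | inj₂ 1/suc≤0 = contradiction (begin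
    1#                          ≡⟨ sym (fromℕ-suc*1/suc k) ⟩
    fromℕ (suc k) * 1/suc k     ≤⟨ *-monoˡ-≤-nonneg (0≤fromℕ (suc k)) 1/suc≤0 ⟩
    fromℕ (suc k) * 0#          ≡⟨ zeroʳ _ ⟩
    0#                          ∎) 1≰0

  *-1/suc-cancel : ∀ k y → fromℕ (suc k) * (y * 1/suc k) ≡ y
  *-1/suc-cancel k y = begin-equality
    fromℕ (suc k) * (y * 1/suc k)   ≡⟨ solve 3 (λ c y i → c :* (y :* i) := (c :* i) :* y) refl (fromℕ (suc k)) y (1/suc k) ⟩
    (fromℕ (suc k) * 1/suc k) * y   ≡⟨ cong (_* y) (fromℕ-suc*1/suc k) ⟩
    1# * y                          ≡⟨ *-identityˡ y ⟩
    y                               ∎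

  *1/suc≤⇒≤* : ∀ {k y z} → y * 1/suc k ≤ z → y ≤ fromℕ (suc k) * z
  *1/suc≤⇒≤* {k} {y} {z} y/c≤z = begin
    y                              ≡⟨ sym (*-1/suc-cancel k y) ⟩
    fromℕ (suc k) * (y * 1/suc k)  ≤⟨ *-monoˡ-≤-nonneg (0≤fromℕ (suc k)) y/c≤z ⟩
    fromℕ (suc k) * z              ∎

  ≤*1/suc⇒*≤ : ∀ {k y z} → z ≤ y * 1/suc k → fromℕ (suc k) * z ≤ y
  ≤*1/suc⇒*≤ {k} {y} {z} z≤y/c = begin
    fromℕ (suc k) * z              ≤⟨ *-monoˡ-≤-nonneg (0≤fromℕ (suc k)) z≤y/c ⟩
    fromℕ (suc k) * (y * 1/suc k)  ≡⟨ *-1/suc-cancel k y ⟩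
    y                              ∎

  ≤*⇒*1/suc≤ : ∀ {k y z} → y ≤ fromℕ (suc k) * z → y * 1/suc k ≤ z
  ≤*⇒*1/suc≤ {k} {y} {z} y≤cz = begin
    y * 1/suc k                    ≡⟨ *-comm y (1/suc k) ⟩
    1/suc k * y                    ≤⟨ *-monoˡ-≤-nonneg (0≤1/suc k) y≤cz ⟩
    1/suc k * (fromℕ (suc k) * z)  ≡⟨ solve 3 (λ i c z → i :* (c :* z) := c :* (z :* i)) refl (1/suc k) (fromℕ (suc k)) z ⟩
    fromℕ (suc k) * (z * 1/suc k)  ≡⟨ *-1/suc-cancel k z ⟩
    z                              ∎

  abs≡-≤ : ∀ {x M Δ} → abs≡ x M → abs≤ x Δ → M ≤ Δ
  abs≡-≤ (inj₁ refl) (x≤Δ , _)  = x≤Δ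
  abs≡-≤ (inj₂ refl) (_ , -x≤Δ) = -x≤Δ

  separate : (ls us : List R) → All (λ u → All (_≤ u) ls) us →
             ∃ λ t → All (_≤ t) ls × All (t ≤_) us
  separate ls us ls≤us =
    max (min 0# us) ls , xs≤max (min 0# us) ls ,
    All.zipWith (λ (t≤u , ls≤u) → max≤v⁺ t≤u ls≤u) (min≤xs 0# us , ls≤us)
    where open Data.List.Extrema ≤-totalOrder using (max; min; xs≤max; min≤xs; max≤v⁺)

module FourierMotzkin (ℝ : RealField) where
  open RealFieldProperties ℝ
  open ≤-Reasoning
  open import Algebra.Properties.Semiring.Sum (CommutativeRing.semiring commutativeRing)
    using (sum; ∑-distrib-+; *-distribˡ-sum; sum-cong-≗)

  -- A coefficient (p , n) stands for the integer p − n.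
  value : ℕ × ℕ → R
  value (p , n) = fromℕ p - fromℕ n

  Balanced : ℕ × ℕ → Set
  Balanced (p , n) = p ≡ n

  linComb : ℕ → ℕ × ℕ → ℕ → ℕ × ℕ → ℕ × ℕ
  linComb a (p , n) b (p′ , n′) = (a ℕ.* p ℕ.+ b ℕ.* p′ , a ℕ.* n ℕ.+ b ℕ.* n′)

  fromℕ-linComb : ∀ a x b y → fromℕ (a ℕ.* x ℕ.+ b ℕ.* y) ≡ fromℕ a * fromℕ x + fromℕ b * fromℕ y
  fromℕ-linComb a x b y = trans (fromℕ-+ (a ℕ.* x) (b ℕ.* y)) (cong₂ _+_ (fromℕ-* a x) (fromℕ-* b y))

  value-linComb : ∀ a c b d → value (linComb a c b d) ≡ fromℕ a * value c + fromℕ b * value d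
  value-linComb a (p , n) b (p′ , n′) = begin-equality
    value (linComb a (p , n) b (p′ , n′))
      ≡⟨ cong₂ _-_ (fromℕ-linComb a p b p′) (fromℕ-linComb a n b n′) ⟩
    (A * fromℕ p + B * fromℕ p′) - (A * fromℕ n + B * fromℕ n′)
      ≡⟨ solve 6 (λ A B p n p′ n′ → (A :* p :+ B :* p′) :- (A :* n :+ B :* n′)
                                    := A :* (p :- n) :+ B :* (p′ :- n′))
               refl A B (fromℕ p) (fromℕ n) (fromℕ p′) (fromℕ n′) ⟩
    A * value (p , n) + B * value (p′ , n′) ∎
    where
    A = fromℕ a
    B = fromℕ b

  value-balanced : ∀ c → Balanced c → value c ≡ 0#
  value-balanced (p , .p) refl = -‿inverseʳ (fromℕ p)

  balanced-linComb : ∀ a c b d → Balanced c → Balanced d → Balanced (linComb a c b d)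
  balanced-linComb a (p , .p) b (q , .q) refl refl = refl

  data Trichotomy (c : ℕ × ℕ) : Set where
    balanced : Balanced c → Trichotomy c
    positive : ∀ r k → c ≡ (suc (r ℕ.+ k) , r) → Trichotomy c
    negative : ∀ r k → c ≡ (r , suc (r ℕ.+ k)) → Trichotomy c

  trichotomy : ∀ c → Trichotomy c
  trichotomy (p , n) with ℕ.compare p n
  ... | ℕ.less    .p k = negative p k refl
  ... | ℕ.equal   .p   = balanced refl
  ... | ℕ.greater .n k = positive n k refl

  value-positive : ∀ r k → value (suc (r ℕ.+ k) , r) ≡ fromℕ (suc k)
  value-positive r k = begin-equality
    fromℕ (suc r ℕ.+ k) - fromℕ r         ≡⟨ cong (λ m → fromℕ m - fromℕ r) (sym (ℕ.+-suc r k)) ⟩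
    fromℕ (r ℕ.+ suc k) - fromℕ r         ≡⟨ cong (_- fromℕ r) (fromℕ-+ r (suc k)) ⟩
    (fromℕ r + fromℕ (suc k)) - fromℕ r   ≡⟨ solve 2 (λ r k → (r :+ k) :- r := k) refl (fromℕ r) (fromℕ (suc k)) ⟩
    fromℕ (suc k)                         ∎

  value-negative : ∀ r k → value (r , suc (r ℕ.+ k)) ≡ - fromℕ (suc k)
  value-negative r k = begin-equality
    fromℕ r - fromℕ (suc r ℕ.+ k)         ≡⟨ cong (λ m → fromℕ r - fromℕ m) (sym (ℕ.+-suc r k)) ⟩
    fromℕ r - fromℕ (r ℕ.+ suc k)         ≡⟨ cong (λ z → fromℕ r - z) (fromℕ-+ r (suc k)) ⟩
    fromℕ r - (fromℕ r + fromℕ (suc k))   ≡⟨ solve 2 (λ r k → r :- (r :+ k) := :- k) refl (fromℕ r) (fromℕ (suc k)) ⟩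
    - fromℕ (suc k)                       ∎

  cross-balanced : ∀ r kp r′ kq →
    Balanced (linComb (suc kq) (suc (r ℕ.+ kp) , r) (suc kp) (r′ , suc (r′ ℕ.+ kq)))
  cross-balanced = identity
    where
    open import Data.Nat.Tactic.RingSolver using (solve-∀)
    identity : ∀ r kp r′ kq → suc kq ℕ.* suc (r ℕ.+ kp) ℕ.+ suc kp ℕ.* r′
                              ≡ suc kq ℕ.* r ℕ.+ suc kp ℕ.* suc (r′ ℕ.+ kq)
    identity = solve-∀

  -- The inequalities Σᵤ value (coeff w u) · xᵤ ≤ rhs w, one per row w; rows can be
  -- combined with natural weights, and rhs may be any map additive under combination.
  record System (m : ℕ) : Set₁ where
    field
      Row : Set
      coeff : Row → Fin m → ℕ × ℕ
      combine : ℕ → Row → ℕ → Row → Row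
      coeff-combine : ∀ a p b q u → coeff (combine a p b q) u ≡ linComb a (coeff p u) b (coeff q u)

  module _ {m : ℕ} (S : System m) where
    open System S

    lhs : (Fin m → R) → Row → R
    lhs x w = sum (λ u → value (coeff w u) * x u)

    lhs-combine : ∀ x a p b q → lhs x (combine a p b q) ≡ fromℕ a * lhs x p + fromℕ b * lhs x q
    lhs-combine x a p b q = begin-equality
      sum (λ u → value (coeff (combine a p b q) u) * x u)
        ≡⟨ sum-cong-≗ {m} term ⟩
      sum (λ u → fromℕ a * (value (coeff p u) * x u) + fromℕ b * (value (coeff q u) * x u))
        ≡⟨ ∑-distrib-+ {m} _ _ ⟩
      sum (λ u → fromℕ a * (value (coeff p u) * x u)) + sum (λ u → fromℕ b * (value (coeff q u) * x u))
        ≡⟨ sym (cong₂ _+_ (*-distribˡ-sum {m} (fromℕ a) _) (*-distribˡ-sum {m} (fromℕ b) _)) ⟩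
      fromℕ a * lhs x p + fromℕ b * lhs x q ∎
      where
      term : ∀ u → value (coeff (combine a p b q) u) * x u
                   ≡ fromℕ a * (value (coeff p u) * x u) + fromℕ b * (value (coeff q u) * x u)
      term u = begin-equality
        value (coeff (combine a p b q) u) * x u
          ≡⟨ cong (λ c → value c * x u) (coeff-combine a p b q u) ⟩
        value (linComb a (coeff p u) b (coeff q u)) * x u
          ≡⟨ cong (_* x u) (value-linComb a (coeff p u) b (coeff q u)) ⟩
        (fromℕ a * value (coeff p u) + fromℕ b * value (coeff q u)) * x u
          ≡⟨ solve 5 (λ A B P Q X → (A :* P :+ B :* Q) :* X := A :* (P :* X) :+ B :* (Q :* X))
                   refl (fromℕ a) (fromℕ b) (value (coeff p u)) (value (coeff q u)) (x u) ⟩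
        fromℕ a * (value (coeff p u) * x u) + fromℕ b * (value (coeff q u) * x u) ∎

    Additive : (Row → R) → Set
    Additive rhs = ∀ a p b q → rhs (combine a p b q) ≡ fromℕ a * rhs p + fromℕ b * rhs q

    BalancedRow : Set
    BalancedRow = Σ Row (λ w → ∀ u → Balanced (coeff w u))

    Solvable : (Row → R) → List Row → Set
    Solvable rhs L = ∃ λ (x : Fin m → R) → All (λ w → lhs x w ≤ rhs w) L

  upper-bound-sound : ∀ k t L R → t ≤ (R - L) * 1/suc k → fromℕ (suc k) * t + L ≤ R
  upper-bound-sound k t L R t≤ = ≤-by-difference (*-monoˡ-≤-nonneg (0≤fromℕ (suc k)) t≤) (begin-equality
    c * ((R - L) * 1/suc k) - c * t   ≡⟨ cong (_- c * t) (*-1/suc-cancel k (R - L)) ⟩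
    (R - L) - c * t                   ≡⟨ solve 4 (λ c t L R → (R :- L) :- c :* t := R :- (c :* t :+ L)) refl c t L R ⟩
    R - (c * t + L)                   ∎)
    where c = fromℕ (suc k)

  lower-bound-sound : ∀ k t L R → (L - R) * 1/suc k ≤ t → - fromℕ (suc k) * t + L ≤ R
  lower-bound-sound k t L R ≤t = ≤-by-difference (*-monoˡ-≤-nonneg (0≤fromℕ (suc k)) ≤t) (begin-equality
    c * t - c * ((L - R) * 1/suc k)   ≡⟨ cong (λ z → c * t - z) (*-1/suc-cancel k (L - R)) ⟩
    c * t - (L - R)                   ≡⟨ solve 4 (λ c t L R → c :* t :- (L :- R) := R :- (:- c :* t :+ L)) refl c t L R ⟩
    R - (- c * t + L)                 ∎)
    where c = fromℕ (suc k)

  lower≤upper : ∀ {β γ ip iq} → β * ip ≡ 1# → γ * iq ≡ 1# → 0# ≤ ip → 0# ≤ iq →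
    ∀ {Lp Lq Rp Rq} → γ * Lp + β * Lq ≤ γ * Rp + β * Rq → (Lq - Rq) * iq ≤ (Rp - Lp) * ip
  lower≤upper {β} {γ} {ip} {iq} β*ip≡1 γ*iq≡1 0≤ip 0≤iq {Lp} {Lq} {Rp} {Rq} combined = 0≤y-x⇒x≤y (begin
    0#                                                        ≤⟨ *-nonneg (*-nonneg 0≤ip 0≤iq) (x≤y⇒0≤y-x combined) ⟩
    (ip * iq) * ((γ * Rp + β * Rq) - (γ * Lp + β * Lq))       ≡⟨ solve 8 (λ ip iq β γ Lp Lq Rp Rq →
        (ip :* iq) :* ((γ :* Rp :+ β :* Rq) :- (γ :* Lp :+ β :* Lq))
          := (γ :* iq) :* ((Rp :- Lp) :* ip) :+ (β :* ip) :* ((Rq :- Lq) :* iq)) refl ip iq β γ Lp Lq Rp Rq ⟩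
    (γ * iq) * ((Rp - Lp) * ip) + (β * ip) * ((Rq - Lq) * iq) ≡⟨ cong₂ (λ u v → u * ((Rp - Lp) * ip) + v * ((Rq - Lq) * iq))
                                                                   γ*iq≡1 β*ip≡1 ⟩
    1# * ((Rp - Lp) * ip) + 1# * ((Rq - Lq) * iq)             ≡⟨ cong₂ _+_ (*-identityˡ _) (*-identityˡ _) ⟩
    (Rp - Lp) * ip + (Rq - Lq) * iq                           ≡⟨ solve 6 (λ Lp Lq Rp Rq ip iq →
        (Rp :- Lp) :* ip :+ (Rq :- Lq) :* iq := (Rp :- Lp) :* ip :- (Lq :- Rq) :* iq) refl Lp Lq Rp Rq ip iq ⟩
    (Rp - Lp) * ip - (Lq - Rq) * iq                           ∎)

  module Elimination {m : ℕ} (S : System (suc m)) where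
    open System S

    shifted : System m
    shifted = record
      { Row = Row
      ; coeff = λ w u → coeff w (suc u)
      ; combine = combine
      ; coeff-combine = λ a p b q u → coeff-combine a p b q (suc u) }

    eliminated : System m
    eliminated = record
      { Row = Σ Row (λ w → Balanced (coeff w zero))
      ; coeff = λ w u → coeff (proj₁ w) (suc u)
      ; combine = λ a p b q → combine a (proj₁ p) b (proj₁ q) ,
          subst Balanced (sym (coeff-combine a (proj₁ p) b (proj₁ q) zero))
                (balanced-linComb a _ b _ (proj₂ p) (proj₂ q))
      ; coeff-combine = λ a p b q u → coeff-combine a (proj₁ p) b (proj₁ q) (suc u) }

    -- Rows with positive (negative) first coefficient bound x₀ from above (below).
    record Upper : Set where
      constructor upper
      field
        row : Row
        r k : ℕ
        coeff₀≡ : coeff row zero ≡ (suc (r ℕ.+ k) , r)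

    record Lower : Set where
      constructor lower
      field
        row : Row
        r k : ℕ
        coeff₀≡ : coeff row zero ≡ (r , suc (r ℕ.+ k))

    Partition : Set
    Partition = List (System.Row eliminated) × List Upper × List Lower

    insert : (w : Row) → Trichotomy (coeff w zero) → Partition → Partition
    insert w (balanced b)     (zs , us , ls) = (w , b) ∷ zs , us , ls
    insert w (positive r k e) (zs , us , ls) = zs , upper w r k e ∷ us , ls
    insert w (negative r k e) (zs , us , ls) = zs , us , lower w r k e ∷ ls

    partition : List Row → Partition
    partition []      = [] , [] , []
    partition (w ∷ L) = insert w (trichotomy (coeff w zero)) (partition L)

    AllParts : (Row → Set) → Partition → Set
    AllParts P (zs , us , ls) = All (P ∘ proj₁) zs × All (P ∘ Upper.row) us × All (P ∘ Lower.row) ls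

    All-insert : ∀ P w t T → AllParts P (insert w t T) → P w × AllParts P T
    All-insert P w (balanced _)     (zs , us , ls) (pw ∷ pzs , pus , pls) = pw , pzs , pus , pls
    All-insert P w (positive _ _ _) (zs , us , ls) (pzs , pw ∷ pus , pls) = pw , pzs , pus , pls
    All-insert P w (negative _ _ _) (zs , us , ls) (pzs , pus , pw ∷ pls) = pw , pzs , pus , pls

    All-partition : ∀ P L → AllParts P (partition L) → All P L
    All-partition P []      _ = []
    All-partition P (w ∷ L) h with All-insert P w (trichotomy (coeff w zero)) (partition L) h
    ... | pw , h′ = pw ∷ All-partition P L h′

    cancel : Upper → Lower → System.Row eliminated
    cancel (upper w r kp e) (lower v r′ kq e′) =
      combine (suc kq) w (suc kp) v ,
      subst Balanced (sym (coeff-combine (suc kq) w (suc kp) v zero))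
            (subst₂ (λ c d → Balanced (linComb (suc kq) c (suc kp) d)) (sym e) (sym e′)
                    (cross-balanced r kp r′ kq))

    eliminate : Partition → List (System.Row eliminated)
    eliminate (zs , us , ls) = zs ++ concatMap (λ p → List.map (cancel p) ls) us

    module _ (rhs : Row → R) (x : Fin m → R) where
      private
        L : Row → R
        L = lhs shifted x

      upperBound : Upper → R
      upperBound (upper w _ k _) = (rhs w - L w) * 1/suc k

      lowerBound : Lower → R
      lowerBound (lower w _ k _) = (L w - rhs w) * 1/suc k

      lowerBound≤upperBound : Additive S rhs → ∀ p q →
        lhs eliminated x (cancel p q) ≤ rhs (proj₁ (cancel p q)) → lowerBound q ≤ upperBound p
      lowerBound≤upperBound additive (upper w r kp e) (lower v r′ kq e′) h =
        lower≤upper (fromℕ-suc*1/suc kp) (fromℕ-suc*1/suc kq) (0≤1/suc kp) (0≤1/suc kq) (begin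
        fromℕ (suc kq) * L w + fromℕ (suc kp) * L v       ≡⟨ sym (lhs-combine shifted x (suc kq) w (suc kp) v) ⟩
        L (combine (suc kq) w (suc kp) v)                 ≤⟨ h ⟩
        rhs (combine (suc kq) w (suc kp) v)               ≡⟨ additive (suc kq) w (suc kp) v ⟩
        fromℕ (suc kq) * rhs w + fromℕ (suc kp) * rhs v   ∎)

      balanced-row-satisfied : ∀ t z → lhs eliminated x z ≤ rhs (proj₁ z) →
                               lhs S (t Vector.∷ x) (proj₁ z) ≤ rhs (proj₁ z)
      balanced-row-satisfied t (w , b) h = begin
        value (coeff w zero) * t + L w   ≡⟨ cong (λ c → c * t + L w) (value-balanced _ b) ⟩
        0# * t + L w                     ≡⟨ trans (cong (_+ L w) (zeroˡ t)) (+-identityˡ (L w)) ⟩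
        L w                              ≤⟨ h ⟩
        rhs w                            ∎

      upper-row-satisfied : ∀ t p → t ≤ upperBound p → lhs S (t Vector.∷ x) (Upper.row p) ≤ rhs (Upper.row p)
      upper-row-satisfied t (upper w r k e) t≤ = begin
        value (coeff w zero) * t + L w      ≡⟨ cong (λ c → value c * t + L w) e ⟩
        value (suc (r ℕ.+ k) , r) * t + L w ≡⟨ cong (λ c → c * t + L w) (value-positive r k) ⟩
        fromℕ (suc k) * t + L w             ≤⟨ upper-bound-sound k t (L w) (rhs w) t≤ ⟩
        rhs w                               ∎

      lower-row-satisfied : ∀ t q → lowerBound q ≤ t → lhs S (t Vector.∷ x) (Lower.row q) ≤ rhs (Lower.row q)
      lower-row-satisfied t (lower w r k e) ≤t = begin
        value (coeff w zero) * t + L w      ≡⟨ cong (λ c → value c * t + L w) e ⟩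
        value (r , suc (r ℕ.+ k)) * t + L w ≡⟨ cong (λ c → c * t + L w) (value-negative r k) ⟩
        - fromℕ (suc k) * t + L w           ≤⟨ lower-bound-sound k t (L w) (rhs w) ≤t ⟩
        rhs w                               ∎

    extend : ∀ rhs → Additive S rhs → (x : Fin m → R) → (T : Partition) →
             All (λ w → lhs eliminated x w ≤ rhs (proj₁ w)) (eliminate T) →
             ∃ λ t → AllParts (λ w → lhs S (t Vector.∷ x) w ≤ rhs w) T
    extend rhs additive x (zs , us , ls) sat =
      t , All.map (λ {z} → balanced-row-satisfied rhs x t z) (All.++⁻ˡ zs sat) ,
          All.map (λ {p} → upper-row-satisfied rhs x t p) (All.map⁻ t≤us) ,
          All.map (λ {q} → lower-row-satisfied rhs x t q) (All.map⁻ ls≤t)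
      where
      cancelled-sat : All (λ p → All (λ q → lhs eliminated x (cancel p q) ≤ rhs (proj₁ (cancel p q))) ls) us
      cancelled-sat = All.map All.map⁻ (All.map⁻ (All.concat⁻ (All.++⁻ʳ zs sat)))

      bounds : All (λ u → All (_≤ u) (List.map (lowerBound rhs x) ls)) (List.map (upperBound rhs x) us)
      bounds = All.map⁺ (All.map (λ {p} → All.map⁺ ∘ All.map (λ {q} → lowerBound≤upperBound rhs x additive p q))
                                 cancelled-sat)

      separation = separate (List.map (lowerBound rhs x) ls) (List.map (upperBound rhs x) us) bounds
      t = proj₁ separation
      ls≤t = proj₁ (proj₂ separation)
      t≤us = proj₂ (proj₂ separation)

    lift : BalancedRow eliminated → BalancedRow S
    lift ((w , b₀) , bs) = w , λ { zero → b₀ ; (suc u) → bs u }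

  -- Farkas' lemma: solvability only depends on the rows F in which every variable cancels.
  fourierMotzkin : ∀ {m} (S : System m) (L : List (System.Row S)) →
    ∃ λ (F : List (BalancedRow S)) → ∀ rhs → Additive S rhs →
      All (λ w → 0# ≤ rhs (proj₁ w)) F → Solvable S rhs L
  fourierMotzkin {zero} S L =
    List.map (λ w → w , λ ()) L , λ rhs _ 0≤rhs → (λ ()) , All.map⁻ 0≤rhs
  fourierMotzkin {suc m} S L = List.map lift F , solution
    where
    open Elimination S
    reduced = fourierMotzkin eliminated (eliminate (partition L))
    F = proj₁ reduced

    solution : ∀ rhs → Additive S rhs → All (λ w → 0# ≤ rhs (proj₁ w)) (List.map lift F) → Solvable S rhs L
    solution rhs additive 0≤F = (t Vector.∷ x) , All-partition (λ w → lhs S (t Vector.∷ x) w ≤ rhs w) L sat′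
      where
      reducedSolution = proj₂ reduced (rhs ∘ proj₁) (λ a p b q → additive a (proj₁ p) b (proj₁ q)) (All.map⁻ 0≤F)
      x = proj₁ reducedSolution
      extension = extend rhs additive x (partition L) (proj₂ reducedSolution)
      t = proj₁ extension
      sat′ = proj₂ extension

repeat : ∀ {A : Set} {m} (q : ℕ) → Vec A m → Vec A (q ℕ.* m)
repeat q xs = Vec.concat (Vec.replicate q xs)

subsets : ∀ n → List (Subset n)
subsets zero    = [] ∷ []
subsets (suc n) = List.map (true ∷_) (subsets n) ++ List.map (false ∷_) (subsets n)

∈-subsets : ∀ {n} (S : Subset n) → S ∈ subsets n
∈-subsets []          = here refl
∈-subsets (true ∷ S)  = ∈.∈-++⁺ˡ (∈.∈-map⁺ (true ∷_) (∈-subsets S))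
∈-subsets (false ∷ S) = ∈.∈-++⁺ʳ _ (∈.∈-map⁺ (false ∷_) (∈-subsets S))

p∩∁p≡⊥ : ∀ {n} (p : Subset n) → p ∩ ∁ p ≡ ⊥
p∩∁p≡⊥ []          = refl
p∩∁p≡⊥ (true ∷ p)  = cong (false ∷_) (p∩∁p≡⊥ p)
p∩∁p≡⊥ (false ∷ p) = cong (false ∷_) (p∩∁p≡⊥ p)

∁-involutive : ∀ {n} (p : Subset n) → ∁ (∁ p) ≡ p
∁-involutive []          = refl
∁-involutive (true ∷ p)  = cong (true ∷_) (∁-involutive p)
∁-involutive (false ∷ p) = cong (false ∷_) (∁-involutive p)

module Counting (ℝ : RealField) where
  open SetFunctions ℝ using (count)

  count-++ : ∀ {n a b} (i : Fin n) (xs : Vec (Subset n) a) (ys : Vec (Subset n) b) →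
             count i (xs Vec.++ ys) ≡ count i xs ℕ.+ count i ys
  count-++ i []       ys = refl
  count-++ i (x ∷ xs) ys =
    trans (cong (_ ℕ.+_) (count-++ i xs ys)) (sym (ℕ.+-assoc (if lookup x i then 1 else 0) _ _))

  count-repeat : ∀ {n m} (i : Fin n) q (xs : Vec (Subset n) m) → count i (repeat q xs) ≡ q ℕ.* count i xs
  count-repeat i zero    xs = refl
  count-repeat i (suc q) xs = trans (count-++ i xs (repeat q xs)) (cong (count i xs ℕ.+_) (count-repeat i q xs))

  count-∁ : ∀ {n m} (i : Fin n) (xs : Vec (Subset n) m) → count i (Vec.map ∁ xs) ℕ.+ count i xs ≡ m
  count-∁ i []       = refl
  count-∁ i (x ∷ xs) rewrite Vec.lookup-map i not x with lookup x i
  ... | false = cong suc (count-∁ i xs)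
  ... | true  = trans (ℕ.+-suc (count i (Vec.map ∁ xs)) (count i xs)) (cong suc (count-∁ i xs))

module Sums (ℝ : RealField) where
  open RealFieldProperties ℝ
  open ≤-Reasoning
  open SetFunctions ℝ using (sumR)

  sumMap : ∀ {A : Set} {m} → (A → R) → Vec A m → R
  sumMap g xs = sumR (Vec.map g xs)

  module _ {A : Set} where

    sumMap-++ : ∀ {a b} (g : A → R) (xs : Vec A a) (ys : Vec A b) →
                sumMap g (xs Vec.++ ys) ≡ sumMap g xs + sumMap g ys
    sumMap-++ g []       ys = sym (+-identityˡ _)
    sumMap-++ g (x ∷ xs) ys = trans (cong (g x +_) (sumMap-++ g xs ys)) (sym (+-assoc _ _ _))

    sumMap-repeat : ∀ {m} (g : A → R) q (xs : Vec A m) → sumMap g (repeat q xs) ≡ fromℕ q * sumMap g xs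
    sumMap-repeat g zero    xs = sym (zeroˡ _)
    sumMap-repeat g (suc q) xs = begin-equality
      sumMap g (xs Vec.++ repeat q xs)             ≡⟨ sumMap-++ g xs (repeat q xs) ⟩
      sumMap g xs + sumMap g (repeat q xs)         ≡⟨ cong (sumMap g xs +_) (sumMap-repeat g q xs) ⟩
      sumMap g xs + fromℕ q * sumMap g xs          ≡⟨ cong (_+ fromℕ q * sumMap g xs) (sym (*-identityˡ _)) ⟩
      1# * sumMap g xs + fromℕ q * sumMap g xs     ≡⟨ sym (distribʳ _ _ _) ⟩
      fromℕ (suc q) * sumMap g xs                  ∎

    sumMap-+ : ∀ {m} (g h : A → R) (xs : Vec A m) →
               sumMap (λ x → g x + h x) xs ≡ sumMap g xs + sumMap h xs
    sumMap-+ g h []       = sym (+-identityˡ 0#)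
    sumMap-+ g h (x ∷ xs) = trans (cong (g x + h x +_) (sumMap-+ g h xs))
      (solve 4 (λ a b c d → (a :+ b) :+ (c :+ d) := (a :+ c) :+ (b :+ d)) refl (g x) (h x) (sumMap g xs) (sumMap h xs))

    sumMap-affine : ∀ {m} (a b : R) (g : A → R) (xs : Vec A m) →
                    sumMap (λ x → a + b * g x) xs ≡ fromℕ m * a + b * sumMap g xs
    sumMap-affine a b g []       = solve 2 (λ a b → con (ℤ.+ 0) := con (ℤ.+ 0) :* a :+ b :* con (ℤ.+ 0)) refl a b
    sumMap-affine {suc m} a b g (x ∷ xs) = begin-equality
      (a + b * g x) + sumMap (λ x → a + b * g x) xs   ≡⟨ cong (a + b * g x +_) (sumMap-affine a b g xs) ⟩
      (a + b * g x) + (fromℕ m * a + b * sumMap g xs) ≡⟨ solve 5 (λ a b y s c → (a :+ b :* y) :+ (c :* a :+ b :* s)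
                                                            := (a :+ c :* a) :+ b :* (y :+ s)) refl a b (g x) (sumMap g xs) (fromℕ m) ⟩
      (a + fromℕ m * a) + b * (g x + sumMap g xs)     ≡⟨ cong (λ z → (z + fromℕ m * a) + b * (g x + sumMap g xs)) (sym (*-identityˡ a)) ⟩
      (1# * a + fromℕ m * a) + b * (g x + sumMap g xs) ≡⟨ cong (_+ b * (g x + sumMap g xs)) (sym (distribʳ a 1# (fromℕ m))) ⟩
      fromℕ (suc m) * a + b * sumMap g (x ∷ xs)       ∎

    sumMap-mono : ∀ {m} {g h : A → R} → (∀ x → g x ≤ h x) → (xs : Vec A m) → sumMap g xs ≤ sumMap h xs
    sumMap-mono g≤h []       = ≤-refl 0#
    sumMap-mono g≤h (x ∷ xs) = +-mono-≤ (g≤h x) (sumMap-mono g≤h xs)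

module LinearApproximation (ℝ : RealField) {n : ℕ} (f : SetFunctions.SetFun ℝ n) where
  open RealFieldProperties ℝ
  open ≤-Reasoning
  open FourierMotzkin ℝ
  open Counting ℝ
  open Sums ℝ
  open SetFunctions ℝ using (count; sumIn; linear; ClosestLinearIsZero; IsMaxAbs)
  open import Algebra.Properties.Semiring.Sum (CommutativeRing.semiring commutativeRing) using (sum)

  Family : Set
  Family = Σ ℕ (Vec (Subset n))

  -- A row (P , N) is the sum of the constraints ℓ(X) − f(X) ≤ Δ over X ∈ N and
  -- f(X) − ℓ(X) ≤ Δ over X ∈ P; the unknowns are the coefficients c₀, c₁, …, cₙ of ℓ.
  Row : Set
  Row = Family × Family

  coeff : Row → Fin (suc n) → ℕ × ℕ
  coeff ((p , _) , (q , _)) zero    = q , p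
  coeff ((_ , P) , (_ , N)) (suc i) = count i N , count i P

  combineFamilies : ℕ → Family → ℕ → Family → Family
  combineFamilies a (p , P) b (q , Q) = a ℕ.* p ℕ.+ b ℕ.* q , repeat a P Vec.++ repeat b Q

  combine : ℕ → Row → ℕ → Row → Row
  combine a (P₁ , N₁) b (P₂ , N₂) = combineFamilies a P₁ b P₂ , combineFamilies a N₁ b N₂

  count-combine : ∀ i a (F : Family) b (G : Family) →
    count i (proj₂ (combineFamilies a F b G)) ≡ a ℕ.* count i (proj₂ F) ℕ.+ b ℕ.* count i (proj₂ G)
  count-combine i a (_ , P) b (_ , Q) =
    trans (count-++ i (repeat a P) (repeat b Q)) (cong₂ ℕ._+_ (count-repeat i a P) (count-repeat i b Q))

  system : System (suc n)
  system = record
    { Row = Row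
    ; coeff = coeff
    ; combine = combine
    ; coeff-combine = λ where
        a (P₁ , N₁) b (P₂ , N₂) zero    → refl
        a (P₁ , N₁) b (P₂ , N₂) (suc i) → cong₂ _,_ (count-combine i a N₁ b N₂) (count-combine i a P₁ b P₂) }

  rhs : R → Row → R
  rhs Δ ((p , P) , (q , N)) = fromℕ (p ℕ.+ q) * Δ + (sumMap f N - sumMap f P)

  rhs-additive : ∀ Δ → Additive system (rhs Δ)
  rhs-additive Δ a ((p₁ , P₁) , (q₁ , N₁)) b ((p₂ , P₂) , (q₂ , N₂)) = begin-equality
    fromℕ ((a ℕ.* p₁ ℕ.+ b ℕ.* p₂) ℕ.+ (a ℕ.* q₁ ℕ.+ b ℕ.* q₂)) * Δ
      + (sumMap f (repeat a N₁ Vec.++ repeat b N₂) - sumMap f (repeat a P₁ Vec.++ repeat b P₂))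
      ≡⟨ cong₂ (λ u v → u * Δ + v)
           (trans (fromℕ-+ (a ℕ.* p₁ ℕ.+ b ℕ.* p₂) _) (cong₂ _+_ (fromℕ-linComb a p₁ b p₂) (fromℕ-linComb a q₁ b q₂)))
           (cong₂ _-_ (sum-combine N₁ N₂) (sum-combine P₁ P₂)) ⟩
    ((A * fromℕ p₁ + B * fromℕ p₂) + (A * fromℕ q₁ + B * fromℕ q₂)) * Δ
      + ((A * sumMap f N₁ + B * sumMap f N₂) - (A * sumMap f P₁ + B * sumMap f P₂))
      ≡⟨ solve 11 (λ A B p₁ p₂ q₁ q₂ Δ n₁ n₂ s₁ s₂ →
            ((A :* p₁ :+ B :* p₂) :+ (A :* q₁ :+ B :* q₂)) :* Δ :+ ((A :* n₁ :+ B :* n₂) :- (A :* s₁ :+ B :* s₂))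
            := A :* ((p₁ :+ q₁) :* Δ :+ (n₁ :- s₁)) :+ B :* ((p₂ :+ q₂) :* Δ :+ (n₂ :- s₂)))
          refl A B (fromℕ p₁) (fromℕ p₂) (fromℕ q₁) (fromℕ q₂) Δ (sumMap f N₁) (sumMap f N₂) (sumMap f P₁) (sumMap f P₂) ⟩
    A * ((fromℕ p₁ + fromℕ q₁) * Δ + (sumMap f N₁ - sumMap f P₁))
      + B * ((fromℕ p₂ + fromℕ q₂) * Δ + (sumMap f N₂ - sumMap f P₂))
      ≡⟨ sym (cong₂ (λ u v → A * (u * Δ + (sumMap f N₁ - sumMap f P₁)) + B * (v * Δ + (sumMap f N₂ - sumMap f P₂)))
                    (fromℕ-+ p₁ q₁) (fromℕ-+ p₂ q₂)) ⟩
    A * rhs Δ ((p₁ , P₁) , (q₁ , N₁)) + B * rhs Δ ((p₂ , P₂) , (q₂ , N₂)) ∎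
    where
    A = fromℕ a
    B = fromℕ b
    sum-combine : ∀ {r s} (X : Vec (Subset n) r) (Y : Vec (Subset n) s) →
                  sumMap f (repeat a X Vec.++ repeat b Y) ≡ A * sumMap f X + B * sumMap f Y
    sum-combine X Y = trans (sumMap-++ f (repeat a X) (repeat b Y)) (cong₂ _+_ (sumMap-repeat f a X) (sumMap-repeat f b Y))

  below above : Subset n → Row
  below S = (0 , []) , (1 , S ∷ [])
  above S = (1 , S ∷ []) , (0 , [])

  constraints : List Row
  constraints = List.map below (subsets n) ++ List.map above (subsets n)

  sum-indicator : ∀ {m} (c : Fin m → R) (S : Subset m) →
                  sum (λ i → value (count i (S ∷ []) , 0) * c i) ≡ sumIn c S
  sum-indicator c []      = refl
  sum-indicator c (b ∷ S) = cong₂ _+_ (bit b) (sum-indicator (c ∘ suc) S)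
    where
    bit : ∀ b → value ((if b then 1 else 0) ℕ.+ 0 , 0) * c zero ≡ (if b then c zero else 0#)
    bit true  = solve 1 (λ y → (con (ℤ.+ 1) :- con (ℤ.+ 0)) :* y := y) refl (c zero)
    bit false = solve 1 (λ y → (con (ℤ.+ 0) :- con (ℤ.+ 0)) :* y := con (ℤ.+ 0)) refl (c zero)

  sum-indicator⁻ : ∀ {m} (c : Fin m → R) (S : Subset m) →
                   sum (λ i → value (0 , count i (S ∷ [])) * c i) ≡ - sumIn c S
  sum-indicator⁻ c []      = sym -0#≈0#
  sum-indicator⁻ c (b ∷ S) = trans (cong₂ _+_ (bit b) (sum-indicator⁻ (c ∘ suc) S)) (-‿+-comm _ _)
    where
    bit : ∀ b → value (0 , (if b then 1 else 0) ℕ.+ 0) * c zero ≡ - (if b then c zero else 0#)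
    bit true  = solve 1 (λ y → (con (ℤ.+ 0) :- con (ℤ.+ 1)) :* y := :- y) refl (c zero)
    bit false = solve 1 (λ y → (con (ℤ.+ 0) :- con (ℤ.+ 0)) :* y := :- con (ℤ.+ 0)) refl (c zero)

  approximation : ∀ Δ (x : Fin (suc n) → R) → All (λ w → lhs system x w ≤ rhs Δ w) constraints →
                  ∀ S → abs≤ (f S - linear (x zero) (x ∘ suc) S) Δ
  approximation Δ x sat S = f-ℓ≤Δ , ℓ-f≤Δ
    where
    c = x ∘ suc
    below-sat = All.lookup sat (∈.∈-++⁺ˡ (∈.∈-map⁺ below (∈-subsets S)))
    above-sat = All.lookup sat (∈.∈-++⁺ʳ _ (∈.∈-map⁺ above (∈-subsets S)))

    f-ℓ≤Δ : f S - linear (x zero) c S ≤ Δ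
    f-ℓ≤Δ = ≤-by-difference
      (subst (_≤ rhs Δ (above S)) (cong (value (0 , 1) * x zero +_) (sum-indicator⁻ c S)) above-sat)
      (solve 4 (λ Δ fS x₀ Σ → (con (ℤ.+ 1) :* Δ :+ (con (ℤ.+ 0) :- (fS :+ con (ℤ.+ 0))))
                                :- ((con (ℤ.+ 0) :- con (ℤ.+ 1)) :* x₀ :+ :- Σ)
                              := Δ :- (fS :- (x₀ :+ Σ)))
             refl Δ (f S) (x zero) (sumIn c S))

    ℓ-f≤Δ : - (f S - linear (x zero) c S) ≤ Δ
    ℓ-f≤Δ = ≤-by-difference
      (subst (_≤ rhs Δ (below S)) (cong (value (1 , 0) * x zero +_) (sum-indicator c S)) below-sat)
      (solve 4 (λ Δ fS x₀ Σ → (con (ℤ.+ 1) :* Δ :+ ((fS :+ con (ℤ.+ 0)) :- con (ℤ.+ 0)))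
                                :- ((con (ℤ.+ 1) :- con (ℤ.+ 0)) :* x₀ :+ Σ)
                              := Δ :- (:- (fS :- (x₀ :+ Σ))))
             refl Δ (f S) (x zero) (sumIn c S))

  -- A balanced row forces Δ ≥ excess, since its left-hand side vanishes.
  excess : BalancedRow system → R
  excess (((zero  , _) , _) , _) = 0#
  excess (((suc k , P) , (_ , N)) , _) = (sumMap f P - sumMap f N) * 1/suc (k ℕ.+ suc k)

  0≤rhs : ∀ Δ (w : BalancedRow system) → excess w ≤ Δ → 0# ≤ rhs Δ (proj₁ w)
  0≤rhs Δ (((zero , []) , (zero , [])) , _) _ = begin
    0#                   ≡⟨ solve 1 (λ Δ → con (ℤ.+ 0) := con (ℤ.+ 0) :* Δ :+ (con (ℤ.+ 0) :- con (ℤ.+ 0))) refl Δ ⟩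
    0# * Δ + (0# - 0#)   ∎
  0≤rhs Δ (((zero , []) , (suc _ , _)) , bal) _ = contradiction (bal zero) λ ()
  0≤rhs Δ (((suc k , P) , (q , N)) , bal) excess≤Δ with bal zero
  ... | refl = begin
    0#                                              ≤⟨ x≤y⇒0≤y-x (*1/suc≤⇒≤* {k ℕ.+ suc k} excess≤Δ) ⟩
    fromℕ (suc (k ℕ.+ suc k)) * Δ - (sumMap f P - sumMap f N)
      ≡⟨ solve 3 (λ cΔ p n → cΔ :- (p :- n) := cΔ :+ (n :- p)) refl _ (sumMap f P) (sumMap f N) ⟩
    rhs Δ ((suc k , P) , (suc k , N))               ∎

  record Certificate (M : R) : Set where
    constructor certificate
    field
      k : ℕ
      P N : Vec (Subset n) (suc k)
      count-≡ : ∀ i → count i P ≡ count i N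
      bound : fromℕ (suc k ℕ.+ suc k) * M ≤ sumMap f P - sumMap f N

  certificate-≤excess : ∀ {M} (w : BalancedRow system) → M ≤ excess w → Certificate M
  certificate-≤excess {M} (((zero , _) , _) , _) M≤0 =
    certificate 0 (⊥ ∷ []) (⊥ ∷ []) (λ _ → refl) (begin
      fromℕ 2 * M      ≤⟨ *-monoˡ-≤-nonneg (0≤fromℕ 2) M≤0 ⟩
      fromℕ 2 * 0#     ≡⟨ trans (zeroʳ _) (sym (-‿inverseʳ _)) ⟩
      sumMap f (⊥ ∷ []) - sumMap f (⊥ ∷ []) ∎)
  certificate-≤excess (((suc k , P) , (q , N)) , bal) M≤excess with bal zero
  ... | refl = certificate k P N (λ i → sym (bal (suc i))) (≤*1/suc⇒*≤ {k ℕ.+ suc k} M≤excess)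

  closest⇒certificate : ClosestLinearIsZero f → ∀ M → IsMaxAbs f M → Certificate M
  closest⇒certificate closest M (_ , S , |fS|≡M) = certificate-≤excess w* (abs≡-≤ |fS|≡M (|f|≤Δ S))
    where
    open Data.List.Extrema ≤-totalOrder using (argmax; f[xs]≤f[argmax])
    trivial : BalancedRow system
    trivial = ((0 , []) , (0 , [])) , λ { zero → refl ; (suc i) → refl }
    reduction = fourierMotzkin system constraints
    F = proj₁ reduction
    w* = argmax excess trivial F
    Δ = excess w*
    solution = proj₂ reduction (rhs Δ) (rhs-additive Δ) (All.map (λ {w} → 0≤rhs Δ w) (f[xs]≤f[argmax] trivial F))
    x = proj₁ solution
    |f|≤Δ = closest (x zero) (x ∘ suc) Δ (approximation Δ x (proj₂ solution))

module Construction (ℝ : RealField) {n : ℕ} (ε : RealField.R ℝ) (f : SetFunctions.SetFun ℝ n)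
                    (modular : SetFunctions.WeaklyModular ℝ ε f) (M : RealField.R ℝ) where
  open RealFieldProperties ℝ
  open Counting ℝ
  open Sums ℝ
  open LinearApproximation ℝ f using (Certificate)
  open SetFunctions ℝ using (count; sumR; deficit; surplus; averageDeficit; averageSurplus; complements)

  cost : Subset n → R
  cost X = deficit f M X + surplus f M (∁ X)

  c : R
  c = f ⊤ + f ⊥

  modular-∁ : ∀ X → abs≤ (f X + f (∁ X) - f ⊤ - f ⊥) ε
  modular-∁ X = subst₂ (λ U I → abs≤ (f X + f (∁ X) - f U - f I) ε) (p∪∁p≡⊤ X) (p∩∁p≡⊥ X)
                       (modular X (∁ X) (λ _ → x∈p⇒x∉∁p))

  cost-≤ : ∀ X → cost X ≤ (ε + c + (M + M)) + - fromℕ 2 * f X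
  cost-≤ X = ≤-by-difference (proj₁ (modular-∁ X))
    (solve 6 (λ ε M fU fI fX f∁X → ε :- (fX :+ f∁X :- fU :- fI)
                                   := ((ε :+ (fU :+ fI) :+ (M :+ M)) :+ :- con (ℤ.+ 2) :* fX) :- ((M :- fX) :+ (f∁X :+ M)))
           refl ε M (f ⊤) (f ⊥) (f X) (f (∁ X)))

  cost-∁-≤ : ∀ X → cost (∁ X) ≤ (ε - c + (M + M)) + fromℕ 2 * f X
  cost-∁-≤ X = subst (λ Y → (M - f (∁ X)) + (f Y + M) ≤ (ε - c + (M + M)) + fromℕ 2 * f X)
                     (sym (∁-involutive X))
    (≤-by-difference (proj₂ (modular-∁ X)) (solve 6 (λ ε M fU fI fX f∁X → ε :- (:- (fX :+ f∁X :- fU :- fI))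
                                   := ((ε :- (fU :+ fI) :+ (M :+ M)) :+ con (ℤ.+ 2) :* fX) :- ((M :- f∁X) :+ (fX :+ M)))
           refl ε M (f ⊤) (f ⊥) (f X) (f (∁ X))))

  module _ (cert : Certificate M) where
    open Certificate cert

    family : (q : ℕ) → Vec (Subset n) (q ℕ.* suc k ℕ.+ q ℕ.* suc k)
    family q = repeat q P Vec.++ Vec.map ∁ (repeat q N)

    count-family : ∀ q i → count i (family q) ≡ q ℕ.* suc k
    count-family q i = begin
      count i (family q)                ≡⟨ count-++ i (repeat q P) (Vec.map ∁ (repeat q N)) ⟩
      count i (repeat q P) ℕ.+ C        ≡⟨ cong (ℕ._+ C) (count-repeat i q P) ⟩
      q ℕ.* count i P ℕ.+ C             ≡⟨ cong (λ m → q ℕ.* m ℕ.+ C) (count-≡ i) ⟩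
      q ℕ.* count i N ℕ.+ C             ≡⟨ cong (ℕ._+ C) (sym (count-repeat i q N)) ⟩
      count i (repeat q N) ℕ.+ C        ≡⟨ ℕ.+-comm (count i (repeat q N)) C ⟩
      C ℕ.+ count i (repeat q N)        ≡⟨ count-∁ i (repeat q N) ⟩
      q ℕ.* suc k                       ∎
      where
      open ≡-Reasoning
      C = count i (Vec.map ∁ (repeat q N))

    scaled-bound : ∀ q → (fromℕ (q ℕ.* suc k) + fromℕ (q ℕ.* suc k)) * M ≤ sumMap f (repeat q P) - sumMap f (repeat q N)
    scaled-bound q = begin
      (fromℕ (q ℕ.* suc k) + fromℕ (q ℕ.* suc k)) * M ≡⟨ cong (_* M) (sym (fromℕ-+ (q ℕ.* suc k) _)) ⟩
      fromℕ (q ℕ.* suc k ℕ.+ q ℕ.* suc k) * M   ≡⟨ cong (λ m → fromℕ m * M) (sym (ℕ.*-distribˡ-+ q (suc k) (suc k))) ⟩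
      fromℕ (q ℕ.* (suc k ℕ.+ suc k)) * M       ≡⟨ trans (cong (_* M) (fromℕ-* q _)) (*-assoc _ _ M) ⟩
      fromℕ q * (fromℕ (suc k ℕ.+ suc k) * M)   ≤⟨ *-monoˡ-≤-nonneg (0≤fromℕ q) bound ⟩
      fromℕ q * (sumMap f P - sumMap f N)       ≡⟨ solve 3 (λ q p n → q :* (p :- n) := q :* p :- q :* n) refl _ _ _ ⟩
      fromℕ q * sumMap f P - fromℕ q * sumMap f N ≡⟨ sym (cong₂ _-_ (sumMap-repeat f q P) (sumMap-repeat f q N)) ⟩
      sumMap f (repeat q P) - sumMap f (repeat q N) ∎
      where open ≤-Reasoning

    total-cost-≤ : ∀ q → sumMap cost (family q) ≤ fromℕ (q ℕ.* suc k ℕ.+ q ℕ.* suc k) * ε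
    total-cost-≤ q = begin
      sumMap cost (family q)
        ≡⟨ sumMap-++ cost Ps (Vec.map ∁ Ns) ⟩
      sumMap cost Ps + sumMap cost (Vec.map ∁ Ns)
        ≡⟨ cong (λ s → sumMap cost Ps + sumR s) (sym (Vec.map-∘ cost ∁ Ns)) ⟩
      sumMap cost Ps + sumMap (cost ∘ ∁) Ns
        ≤⟨ +-mono-≤ (sumMap-mono cost-≤ Ps) (sumMap-mono cost-∁-≤ Ns) ⟩
      sumMap (λ X → a₊ + - fromℕ 2 * f X) Ps + sumMap (λ X → a₋ + fromℕ 2 * f X) Ns
        ≡⟨ cong₂ _+_ (sumMap-affine a₊ (- fromℕ 2) f Ps) (sumMap-affine a₋ (fromℕ 2) f Ns) ⟩
      (K * a₊ + - fromℕ 2 * sumMap f Ps) + (K * a₋ + fromℕ 2 * sumMap f Ns)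
        ≤⟨ ≤-by-difference (+-mono-≤ (scaled-bound q) (scaled-bound q))
             (solve 6 (λ K ε M c Σ⁺ Σ⁻ →
               ((Σ⁺ :- Σ⁻) :+ (Σ⁺ :- Σ⁻)) :- ((K :+ K) :* M :+ (K :+ K) :* M)
               := (K :+ K) :* ε :- ((K :* (ε :+ c :+ (M :+ M)) :+ :- con (ℤ.+ 2) :* Σ⁺)
                                   :+ (K :* (ε :- c :+ (M :+ M)) :+ con (ℤ.+ 2) :* Σ⁻)))
              refl K ε M c (sumMap f Ps) (sumMap f Ns)) ⟩
      (K + K) * ε                               ≡⟨ cong (_* ε) (sym (fromℕ-+ (q ℕ.* suc k) _)) ⟩
      fromℕ (q ℕ.* suc k ℕ.+ q ℕ.* suc k) * ε ∎
      where
      open ≤-Reasoning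
      Ps = repeat q P
      Ns = repeat q N
      K = fromℕ (q ℕ.* suc k)
      a₊ = ε + c + (M + M)
      a₋ = ε - c + (M + M)

    average-family-≤ : ∀ q → let F = family (suc q) in
      averageDeficit f M F + averageSurplus f M (complements F) ≤ ε
    average-family-≤ q = begin
      sumMap (deficit f M) F * i + sumR (Vec.map (surplus f M) (Vec.map ∁ F)) * i
        ≡⟨ sym (distribʳ i _ _) ⟩
      (sumMap (deficit f M) F + sumR (Vec.map (surplus f M) (Vec.map ∁ F))) * i
        ≡⟨ cong (λ s → (sumMap (deficit f M) F + sumR s) * i) (sym (Vec.map-∘ (surplus f M) ∁ F)) ⟩
      (sumMap (deficit f M) F + sumMap (surplus f M ∘ ∁) F) * i
        ≡⟨ cong (_* i) (sym (sumMap-+ (deficit f M) (surplus f M ∘ ∁) F)) ⟩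
      sumMap cost F * i
        ≤⟨ ≤*⇒*1/suc≤ {j} (total-cost-≤ (suc q)) ⟩
      ε ∎
      where
      open ≤-Reasoning
      F = family (suc q)
      j = k ℕ.+ q ℕ.* suc k ℕ.+ suc q ℕ.* suc k
      i = 1/suc j

lemma2 : (ℝ : RealField) → let open SetFunctions ℝ in
    (n : ℕ) → 2 ≤ℕ n → (ε : R) → (f : SetFun n) → WeaklyModular ε f →
    ClosestLinearIsZero f → (M : R) → IsMaxAbs f M →
    ∃ λ (k′ : ℕ) → 0 < k′ × (∀ (k : ℕ) → 0 < k → k′ ∣ k →
    Σ (Vec (Subset n) (k +ℕ k)) λ PS →
    (∀ (i : Fin n) → count i PS ≡ k) ×
    (averageDeficit f M PS + averageSurplus f M (complements PS) ≤ ε))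
lemma2 ℝ n _ ε f modular closest M max-abs = suc (Certificate.k cert) , s≤s z≤n , balancedFamily
  where
  open SetFunctions ℝ
  open LinearApproximation ℝ f using (Certificate; closest⇒certificate)
  open Construction ℝ ε f modular M
  cert = closest⇒certificate closest M max-abs
  balancedFamily : ∀ k → 0 < k → suc (Certificate.k cert) ∣ k →
    Σ (Vec (Subset n) (k +ℕ k)) λ PS →
      (∀ i → count i PS ≡ k) × (averageDeficit f M PS + averageSurplus f M (complements PS) ≤ ε)
  balancedFamily _ () (divides zero refl)
  balancedFamily _ _  (divides (suc q) refl) =
    family cert (suc q) , count-family cert (suc q) , average-family-≤ cert q
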